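{- For all contexts $\Gamma,\Delta$ and terms $M, A$: if $\Gamma\subseteq\Delta$, $\Delta\ \mathrm{ok}$ and $\Gamma\vdash M:A$, then $\Delta\vdash M:A$.
   Context: Variables $\mathcal{V}$: a type with decidable equality and maps $\mathrm{encode}:\mathcal{V}\to\mathbb{N}$, $\mathrm{decode}:\mathbb{N}\to\mathcal{V}$ with $\mathrm{encode}(\mathrm{decode}\,n)=n$. Constants $\mathcal{C}$: any type. Terms: $\mathsf{c}\,k$, $\mathsf{v}\,x$, $\lambda[x:A]M$, $\Pi[x:A]B$, $M\cdot N$. Free-variable list: $\mathrm{fv}(\mathsf{c}\,k)=[\,]$, $\mathrm{fv}(\mathsf{v}\,x)=[x]$, $\mathrm{fv}(\lambda[x:A]M)=\mathrm{fv}\,A\mathbin{++}(\mathrm{fv}\,M-x)$, likewise $\Pi$, $\mathrm{fv}(M\cdot N)=\mathrm{fv}\,M\mathbin{++}\mathrm{fv}\,N$ ($xs-x$ removes all occurrences of $x$). Substitutions $\sigma:\mathcal{V}\to\Lambda$; $\iota\,x=\mathsf{v}\,x$; $(\sigma,x:=N)$ sends $x$ to $N$, $y\neq x$ to $\sigma\,y$. Fix $\chi':\mathrm{List}\,\mathbb{N}\to\mathbb{N}$ with $\chi'(ns)\notin ns$; $X'(xs)=\mathrm{decode}(\chi'(\mathrm{map\ encode}\ xs))$; $X(\sigma,xs)=X'$(concatenation of $\mathrm{fv}(\sigma\,y)$ for $y$ in $xs$). Substitution: $\mathsf{c}\,k\bullet\sigma=\mathsf{c}\,k$, $\mathsf{v}\,x\bullet\sigma=\sigma\,x$,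 $(M\cdot N)\bullet\sigma=(M\bullet\sigma)\cdot(N\bullet\sigma)$, $(\lambda[x:A]M)\bullet\sigma=\lambda[y:A\bullet\sigma](M\bullet(\sigma,x:=\mathsf{v}\,y))$ with $y=X(\sigma,\mathrm{fv}\,M-x)$, analogously for $\Pi$ (with $y=X(\sigma,\mathrm{fv}\,B-x)$). $M[x:=N]=M\bullet(\iota,x:=N)$. Alpha-conversion $\sim_\alpha$: inductive, $\mathsf{c}\,k\sim_\alpha\mathsf{c}\,k$, $\mathsf{v}\,x\sim_\alpha\mathsf{v}\,x$, congruence for application, and $\lambda[x:A]M\sim_\alpha\lambda[x':A']M'$ whenever $A\sim_\alpha A'$, $y\notin\mathrm{fv}\,M-x$, $y\notin\mathrm{fv}\,M'-x'$ and $M[x:=\mathsf{v}\,y]=M'[x':=\mathsf{v}\,y]$ syntactically, for some $y$ (same for $\Pi$). Beta: the contextual closure of a relation $S$ is the least relation containing $S$ and closed under rewriting in the body or annotation of $\lambda$, in the codomain or domain of $\Pi$, and in either side of an application; $\to_\beta$ is the contextual closure of $(\lambda[x:A]M)\cdot N\ \triangleright\ M[x:=N]$; $\simeq_\beta$ is the reflexive–symmetric–transitive closure of $\sim_\alpha\cup\to_\beta$. PTS: fix $\mathcal{A}\subseteq\mathcal{C}^2$ (axioms) and $\mathcal{R}\subseteq\mathcal{C}^3$ (rules). A context is a list of pairs $(x,A)$; $\Gamma,x:A$ denotes $(x,A)::\Gamma$; $\mathrm{dom}\,\Gamma$ is the list of first components; $\Gamma\subseteq\Delta$ means every pair $(x,A)\in\Gamma$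 also belongs to $\Delta$. The judgments $\Gamma\ \mathrm{ok}$ and $\Gamma\vdash M:A$ are mutually inductively defined by: (nil) $[\,]\ \mathrm{ok}$; (cons) if $\Gamma\ \mathrm{ok}$, $\Gamma\vdash A:\mathsf{c}\,s$ and $x\notin\mathrm{dom}\,\Gamma$ then $(\Gamma,x:A)\ \mathrm{ok}$; (sort) if $\Gamma\ \mathrm{ok}$ and $\mathcal{A}\,s_1\,s_2$ then $\Gamma\vdash\mathsf{c}\,s_1:\mathsf{c}\,s_2$; (prod) if $\Gamma\vdash A:\mathsf{c}\,s_1$, for every $y\notin\mathrm{dom}\,\Gamma$ we have $\Gamma,y:A\vdash B[x:=\mathsf{v}\,y]:\mathsf{c}\,s_2$, and $\mathcal{R}\,s_1\,s_2\,s_3$, then $\Gamma\vdash\Pi[x:A]B:\mathsf{c}\,s_3$; (var) if $\Gamma\ \mathrm{ok}$ and $(x,A)\in\Gamma$ then $\Gamma\vdash\mathsf{v}\,x:A$; (abs) if $\Gamma\vdash A:\mathsf{c}\,s_1$, for every $z\notin\mathrm{dom}\,\Gamma$ both $\Gamma,z:A\vdash B[y:=\mathsf{v}\,z]:\mathsf{c}\,s_2$ and $\Gamma,z:A\vdash M[x:=\mathsf{v}\,z]:B[y:=\mathsf{v}\,z]$, and $\mathcal{R}\,s_1\,s_2\,s_3$, then $\Gamma\vdash\lambda[x:A]M:\Pi[y:A]B$; (app) if $\Gamma\vdash M:\Pi[x:A]B$, $\Gamma\vdash N:A$ and $\Gamma\vdash B[x:=N]:\mathsf{c}\,s$, then $\Gamma\vdash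 M\cdot N:B[x:=N]$; (conv) if $\Gamma\vdash M:A$, $A\simeq_\beta B$ and $\Gamma\vdash B:\mathsf{c}\,s$ then $\Gamma\vdash M:B$. -}

module Defs where

open import Data.Nat using (ℕ)
open import Data.List using (List; []; _∷_; _++_; map; concatMap; filter)
open import Data.List.Membership.Propositional using (_∈_; _∉_)
open import Data.Product using (_×_; _,_; proj₁)
open import Relation.Binary.PropositionalEquality using (_≡_)
open import Relation.Binary.Definitions using (DecidableEquality)
open import Relation.Nullary using (¬?; yes; no)
open import Relation.Binary.Construct.Closure.Equivalence using (EqClosure)
open import Data.Sum using (_⊎_)

record Setup : Set₁ where
  field
    𝒱 : Set
    _≟𝒱_ : DecidableEquality 𝒱
    encode : 𝒱 → ℕ
    decode : ℕ → 𝒱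
    encode-decode : ∀ n → encode (decode n) ≡ n
    𝒞 : Set
    χ′ : List ℕ → ℕ
    χ′-fresh : ∀ ns → χ′ ns ∉ ns
    Axiom : 𝒞 → 𝒞 → Set
    Rule : 𝒞 → 𝒞 → 𝒞 → Set

module PTS (S : Setup) where
  open Setup S

  infixl 7 _·_
  data Λ : Set where
    c   : 𝒞 → Λ
    v   : 𝒱 → Λ
    lam : 𝒱 → Λ → Λ → Λ     -- lam x A M  =  λ[x:A]M
    pi  : 𝒱 → Λ → Λ → Λ     -- pi x A B   =  Π[x:A]B
    _·_ : Λ → Λ → Λ

  _-_ : List 𝒱 → 𝒱 → List 𝒱
  xs - x = filter (λ y → ¬? (y ≟𝒱 x)) xs

  fv : Λ → List 𝒱
  fv (c k) = []
  fv (v x) = x ∷ []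
  fv (lam x A M) = fv A ++ (fv M - x)
  fv (pi x A B) = fv A ++ (fv B - x)
  fv (M · N) = fv M ++ fv N

  Subst : Set
  Subst = 𝒱 → Λ

  ι : Subst
  ι x = v x

  _,_≔_ : Subst → 𝒱 → Λ → Subst
  (σ , x ≔ N) y with y ≟𝒱 x
  ... | yes _ = N
  ... | no _ = σ y

  X′ : List 𝒱 → 𝒱
  X′ xs = decode (χ′ (map encode xs))

  X : Subst → List 𝒱 → 𝒱
  X σ xs = X′ (concatMap (λ y → fv (σ y)) xs)

  infixl 6 _●_
  _●_ : Λ → Subst → Λ
  c k ● σ = c k
  v x ● σ = σ x
  (M · N) ● σ = (M ● σ) · (N ● σ)
  lam x A M ● σ = let y = X σ (fv M - x) in lam y (A ● σ) (M ● (σ , x ≔ v y))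
  pi x A B ● σ = let y = X σ (fv B - x) in pi y (A ● σ) (B ● (σ , x ≔ v y))

  _[_≔_] : Λ → 𝒱 → Λ → Λ
  M [ x ≔ N ] = M ● (ι , x ≔ N)

  data _∼α_ : Λ → Λ → Set where
    α-c : ∀ {k} → c k ∼α c k
    α-v : ∀ {x} → v x ∼α v x
    α-app : ∀ {M M′ N N′} → M ∼α M′ → N ∼α N′ → (M · N) ∼α (M′ · N′)
    α-lam : ∀ {x x′ A A′ M M′} (y : 𝒱) → A ∼α A′ → y ∉ (fv M - x) → y ∉ (fv M′ - x′)
          → M [ x ≔ v y ] ≡ M′ [ x′ ≔ v y ] → lam x A M ∼α lam x′ A′ M′
    α-pi : ∀ {x x′ A A′ B B′} (y : 𝒱) → A ∼α A′ → y ∉ (fv B - x) → y ∉ (fv B′ - x′)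
          → B [ x ≔ v y ] ≡ B′ [ x′ ≔ v y ] → pi x A B ∼α pi x′ A′ B′

  data Ctx (R : Λ → Λ → Set) : Λ → Λ → Set where
    base  : ∀ {M N} → R M N → Ctx R M N
    lam-body : ∀ {x A M M′} → Ctx R M M′ → Ctx R (lam x A M) (lam x A M′)
    lam-ann  : ∀ {x A A′ M} → Ctx R A A′ → Ctx R (lam x A M) (lam x A′ M)
    pi-cod   : ∀ {x A B B′} → Ctx R B B′ → Ctx R (pi x A B) (pi x A B′)
    pi-dom   : ∀ {x A A′ B} → Ctx R A A′ → Ctx R (pi x A B) (pi x A′ B)
    app-l    : ∀ {M M′ N} → Ctx R M M′ → Ctx R (M · N) (M′ · N)
    app-r    : ∀ {M N N′} → Ctx R N N′ → Ctx R (M · N) (M · N′)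

  data _▷β_ : Λ → Λ → Set where
    β : ∀ {x A M N} → (lam x A M · N) ▷β (M [ x ≔ N ])

  _→β_ : Λ → Λ → Set
  _→β_ = Ctx _▷β_

  _≃β_ : Λ → Λ → Set
  _≃β_ = EqClosure (λ M N → (M ∼α N) ⊎ (M →β N))

  Context : Set
  Context = List (𝒱 × Λ)

  dom : Context → List 𝒱
  dom = map proj₁

  _⊆_ : Context → Context → Set
  Γ ⊆ Δ = ∀ {p} → p ∈ Γ → p ∈ Δ

  _,_∶_ : Context → 𝒱 → Λ → Context
  Γ , x ∶ A = (x , A) ∷ Γ

  infix 4 _ok _⊢_∶_
  data _ok : Context → Set
  data _⊢_∶_ : Context → Λ → Λ → Set

  data _ok where
    nil  : [] ok
    cons : ∀ {Γ x A s} → Γ ok → Γ ⊢ A ∶ c s → x ∉ dom Γ → (Γ , x ∶ A) ok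

  data _⊢_∶_ where
    sort : ∀ {Γ s₁ s₂} → Γ ok → Axiom s₁ s₂ → Γ ⊢ c s₁ ∶ c s₂
    prod : ∀ {Γ x A B s₁ s₂ s₃} → Γ ⊢ A ∶ c s₁
         → (∀ y → y ∉ dom Γ → (Γ , y ∶ A) ⊢ B [ x ≔ v y ] ∶ c s₂)
         → Rule s₁ s₂ s₃ → Γ ⊢ pi x A B ∶ c s₃
    var  : ∀ {Γ x A} → Γ ok → (x , A) ∈ Γ → Γ ⊢ v x ∶ A
    abs  : ∀ {Γ x y A M B s₁ s₂ s₃} → Γ ⊢ A ∶ c s₁
         → (∀ z → z ∉ dom Γ → (Γ , z ∶ A) ⊢ B [ y ≔ v z ] ∶ c s₂)
         → (∀ z → z ∉ dom Γ → (Γ , z ∶ A) ⊢ M [ x ≔ v z ] ∶ B [ y ≔ v z ])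
         → Rule s₁ s₂ s₃ → Γ ⊢ lam x A M ∶ pi y A B
    app  : ∀ {Γ M N x A B s} → Γ ⊢ M ∶ pi x A B → Γ ⊢ N ∶ A
         → Γ ⊢ B [ x ≔ N ] ∶ c s → Γ ⊢ M · N ∶ B [ x ≔ N ]
    conv : ∀ {Γ M A B s} → Γ ⊢ M ∶ A → A ≃β B → Γ ⊢ B ∶ c s → Γ ⊢ M ∶ B

module Submission where

open import Defs
open import Data.List.Relation.Binary.Subset.Propositional.Properties using (map⁺; ∷⁺ʳ)
open import Data.List.Membership.Propositional using (_∉_)
open import Data.Product using (proj₁)
open import Function using (_∘_)

module Weakening (S : Setup) where
  open PTS S

  ∉dom-antimono : ∀ {Γ Δ} → Γ ⊆ Δ → ∀ {y} → y ∉ dom Δ → y ∉ dom Γ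
  ∉dom-antimono Γ⊆Δ y∉Δ = y∉Δ ∘ map⁺ proj₁ Γ⊆Δ

  -- Binder premises range over all fresh variables, and a variable fresh for Δ is
  -- fresh for Γ, so no renaming is needed: weakening is a plain induction.
  weaken : ∀ {Γ Δ M A} → Γ ⊆ Δ → Δ ok → Γ ⊢ M ∶ A → Δ ⊢ M ∶ A

  weaken-fresh : ∀ {Γ Δ A s z M B} → Γ ⊆ Δ → Δ ok → Δ ⊢ A ∶ c s → z ∉ dom Δ
               → (z ∉ dom Γ → (Γ , z ∶ A) ⊢ M ∶ B) → (Δ , z ∶ A) ⊢ M ∶ B
  weaken-fresh Γ⊆Δ Δok ⊢A z∉Δ ⊢M =
    weaken (∷⁺ʳ _ Γ⊆Δ) (cons Δok ⊢A z∉Δ) (⊢M (∉dom-antimono Γ⊆Δ z∉Δ))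

  weaken Γ⊆Δ Δok (sort _ ax) = sort Δok ax
  weaken Γ⊆Δ Δok (var _ x∈Γ) = var Δok (Γ⊆Δ x∈Γ)
  weaken Γ⊆Δ Δok (prod ⊢A ⊢B r) =
    prod ⊢A′ (λ z z∉ → weaken-fresh Γ⊆Δ Δok ⊢A′ z∉ (⊢B z)) r
    where ⊢A′ = weaken Γ⊆Δ Δok ⊢A
  weaken Γ⊆Δ Δok (abs ⊢A ⊢B ⊢M r) =
    abs ⊢A′ (λ z z∉ → weaken-fresh Γ⊆Δ Δok ⊢A′ z∉ (⊢B z))
            (λ z z∉ → weaken-fresh Γ⊆Δ Δok ⊢A′ z∉ (⊢M z)) r
    where ⊢A′ = weaken Γ⊆Δ Δok ⊢A
  weaken Γ⊆Δ Δok (app ⊢M ⊢N ⊢B) =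
    app (weaken Γ⊆Δ Δok ⊢M) (weaken Γ⊆Δ Δok ⊢N) (weaken Γ⊆Δ Δok ⊢B)
  weaken Γ⊆Δ Δok (conv ⊢M A≃B ⊢B) = conv (weaken Γ⊆Δ Δok ⊢M) A≃B (weaken Γ⊆Δ Δok ⊢B)

lemma15 : (S : Setup) → let open PTS S in
    ∀ (Γ Δ : Context) (M A : Λ) → Γ ⊆ Δ → Δ ok → Γ ⊢ M ∶ A → Δ ⊢ M ∶ A
lemma15 S Γ Δ M A = Weakening.weaken S
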